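{- Let $n\ge1$. For every signed composition $\alpha$ of $n$, $X^0_{(n)}\cdot\widetilde S_\alpha=X^0_{|\alpha|}$ in $\mathbb Q\mathcal B_n$.
   Context: $\mathcal B_n$ consists of bijections $w$ of $\{\pm1,\dots,\pm n\}$ with $w(-i)=-w(i)$, written $w=w_1\cdots w_n$ ($w_i=w(i)$), entries ordered $\cdots<-2<-1<1<2<\cdots$; the product of $\mathbb Q\mathcal B_n$ is composition, $(uv)(i)=u(v(i))$. A signed composition of $n$ is a sequence $\alpha=(a_1,\dots,a_k)$ of nonzero integers with $\sum|a_i|=n$, and $|\alpha|=(|a_1|,\dots,|a_k|)$. $\widetilde S_\alpha$ is the sum of all $w\in\mathcal B_n$ such that, on each of the consecutive intervals of $\{1,\dots,n\}$ of lengths $|a_1|,\dots,|a_k|$, the entries $w_j$ are increasing and have sign equal to the sign of the corresponding $a_i$. For an ordinary composition $\gamma=(c_1,\dots,c_h)$ of $n$, $X^0_\gamma$ is the sum of all $w\in\mathcal B_n$ whose entries are increasing on each of the consecutive intervals of lengths $c_1,\dots,c_h$ (no sign condition); in particular $X^0_{(n)}$ is the sum of all $w$ with $w_1<w_2<\cdots<w_n$. -}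

module Defs where

open import Data.Bool using (Bool; true; false; _∧_; _∨_; not; if_then_else_)
open import Data.Nat as ℕ using (ℕ; zero; suc; _≡ᵇ_; _≤ᵇ_)
open import Data.Integer as ℤ using (ℤ; +_; -[1+_]; ∣_∣; -_)
open import Data.Rational as ℚ using (ℚ; 0ℚ; 1ℚ)
open import Data.List as L using (List; []; _∷_; _++_; upTo; take; drop; filter; concatMap)
open import Data.Vec as V using (Vec; []; _∷_; toList)
open import Data.Vec.Properties using (≡-dec)
open import Data.Nat.ListAction using () renaming (sum to sumN)
open import Relation.Nullary using (does)
open import Relation.Nullary.Decidable using (⌊_⌋)
open import Data.Bool using (T)
open import Relation.Unary using (Decidable)
open import Data.Bool.Properties using (T?)

-- Signed permutations of {±1..±n} are represented by their window
-- w = w₁ ⋯ wₙ as a vector of integers; w(-i) = -w(i).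

entries : ℕ → List ℤ
entries n = L.map (λ k → + suc k) (upTo n) ++ L.map (λ k → -[1+ k ]) (upTo n)

allVecs : ℕ → (m : ℕ) → List (Vec ℤ m)
allVecs n zero = [] ∷ []
allVecs n (suc m) = concatMap (λ x → L.map (x ∷_) (allVecs n m)) (entries n)

elemℕ : ℕ → List ℕ → Bool
elemℕ x [] = false
elemℕ x (y ∷ ys) = (x ≡ᵇ y) ∨ elemℕ x ys

distinct : List ℕ → Bool
distinct [] = true
distinct (x ∷ xs) = not (elemℕ x xs) ∧ distinct xs

allB : {A : Set} → (A → Bool) → List A → Bool
allB p [] = true
allB p (x ∷ xs) = p x ∧ allB p xs

isSigned : (n : ℕ) → Vec ℤ n → Bool
isSigned n w = allB (λ x → (1 ≤ᵇ ∣ x ∣) ∧ (∣ x ∣ ≤ᵇ n)) (toList w)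
             ∧ distinct (L.map ∣_∣ (toList w))

Bn : (n : ℕ) → List (Vec ℤ n)
Bn n = filter (λ w → T? (isSigned n w)) (allVecs n n)

-- value w_{k+1}
at : List ℤ → ℕ → ℤ
at [] k = + 0
at (x ∷ xs) zero = x
at (x ∷ xs) (suc k) = at xs k

act : {n : ℕ} → Vec ℤ n → ℤ → ℤ
act w (+ zero) = + 0
act w (+ suc k) = at (toList w) k
act w -[1+ k ] = - at (toList w) k

compose : {n : ℕ} → Vec ℤ n → Vec ℤ n → Vec ℤ n
compose u v = V.map (act u) v

-- the group algebra QB_n: coefficient functions (zero outside B_n for all
-- elements considered here)
QB : ℕ → Set
QB n = Vec ℤ n → ℚ

sumℚ : List ℚ → ℚ
sumℚ = L.foldr ℚ._+_ 0ℚ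

_⋆_ : {n : ℕ} → QB n → QB n → QB n
_⋆_ {n} f g w = sumℚ (concatMap (λ u → L.map (λ v →
    if does (≡-dec ℤ._≟_ (compose u v) w) then f u ℚ.* g v else 0ℚ) (Bn n)) (Bn n))

indicator : Bool → ℚ
indicator b = if b then 1ℚ else 0ℚ

increasing : List ℤ → Bool
increasing [] = true
increasing (x ∷ []) = true
increasing (x ∷ y ∷ ys) = ⌊ x ℤ.<? y ⌋ ∧ increasing (y ∷ ys)

positive negative : ℤ → Bool
positive x = ⌊ + 0 ℤ.<? x ⌋
negative x = ⌊ x ℤ.<? + 0 ⌋

sameSign : ℤ → List ℤ → Bool
sameSign a xs = if positive a then allB positive xs else allB negative xs

IsSignedComposition : ℕ → List ℤ → Bool
IsSignedComposition n α = allB (λ a → not (∣ a ∣ ≡ᵇ 0)) α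
                        ∧ (sumN (L.map ∣_∣ α) ≡ᵇ n)

absComp : List ℤ → List ℕ
absComp = L.map ∣_∣

stildeCond : List ℤ → List ℤ → Bool
stildeCond [] ws = true
stildeCond (a ∷ α) ws = increasing (take ∣ a ∣ ws) ∧ sameSign a (take ∣ a ∣ ws)
                      ∧ stildeCond α (drop ∣ a ∣ ws)

x0Cond : List ℕ → List ℤ → Bool
x0Cond [] ws = true
x0Cond (c ∷ γ) ws = increasing (take c ws) ∧ x0Cond γ (drop c ws)

Stilde : (n : ℕ) → List ℤ → QB n
Stilde n α w = indicator (isSigned n w ∧ stildeCond α (toList w))

X0 : (n : ℕ) → List ℕ → QB n
X0 n γ w = indicator (isSigned n w ∧ x0Cond γ (toList w))

-- The coefficient of w in X⁰₍ₙ₎ · S̃_α counts the factorisations w = u v with u increasing and v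
-- in the support of S̃_α.  Since u(−i) = −u(i), an increasing u satisfies u(x) < u(y) whenever
-- x < y have the same sign; as v has constant sign and increases on every block of α, w = u v
-- increases on every block of |α|.  Conversely, if w increases on every block, then u must
-- contain εᵢ w_j for every j in the i-th block, εᵢ the sign of aᵢ.  These n entries have distinct
-- absolute values, so u is forced to be their increasing arrangement and v = u⁻¹ w, and this pair
-- is indeed a factorisation.  Hence the coefficient is 1 or 0 according as w does or does not lie
-- in the support of X⁰_{|α|}.
module Submission where

open import Defs
open import Data.Bool using (Bool; true; false; T; _∧_; not; if_then_else_)
open import Data.Bool.Properties using (T-∧; T-∨; T?)
open import Data.Empty using (⊥-elim)
open import Data.Integer as ℤ using (ℤ; +_; -[1+_]; ∣_∣; -_; +<+)
import Data.Integer.Properties as ℤ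
open import Data.List as L
  using (List; []; _∷_; _++_; length; map; take; drop; upTo; concatMap; cartesianProduct)
import Data.List.Properties as L
open import Data.List.Membership.DecPropositional ℤ._≟_ using (_∈?_)
open import Data.List.Membership.Propositional using (_∈_; _∉_)
open import Data.List.Membership.Propositional.Properties
  using (∈-map⁺; ∈-map⁻; ∈-++⁺ˡ; ∈-++⁺ʳ; ∈-upTo⁺; ∈-filter⁺; ∈-cartesianProduct⁺)
open import Data.List.Relation.Binary.Permutation.Propositional using (_↭_; ↭-sym; ↭⇒↭ₛ)
import Data.List.Relation.Binary.Permutation.Propositional.Properties as Perm
import Data.List.Relation.Binary.Permutation.Setoid.Properties as PermSetoid
open import Data.List.Relation.Binary.Subset.Propositional using (_⊆_)
open import Data.List.Relation.Unary.All as All using (All; []; _∷_)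
import Data.List.Relation.Unary.All.Properties as All
open import Data.List.Relation.Unary.AllPairs as AllPairs using (AllPairs; []; _∷_)
import Data.List.Relation.Unary.AllPairs.Properties as AllPairs
open import Data.List.Relation.Unary.Any using (here; there)
open import Data.List.Relation.Unary.Linked.Properties using (Linked⇒AllPairs)
open import Data.List.Relation.Unary.Unique.Propositional using (Unique)
import Data.List.Relation.Unary.Unique.Propositional.Properties as Unique
open import Data.List.Sort ℤ.≤-decTotalOrder using (sort; sort-↭; sort-↗)
open import Data.Nat as ℕ using (ℕ; zero; suc; z≤n; s≤s; _≤_; _<_; _≡ᵇ_; _≤ᵇ_)
open import Data.Nat.ListAction using (sum)
import Data.Nat.Properties as ℕ
open import Data.Product using (Σ; _×_; _,_; proj₁; proj₂)
open import Data.Product.Function.NonDependent.Propositional using (_×-⇔_)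
open import Data.Rational as ℚ using (ℚ; 0ℚ; 1ℚ)
import Data.Rational.Properties as ℚ
open import Data.Sum using (_⊎_; inj₁; inj₂; [_,_]′)
open import Data.Unit using (⊤)
open import Data.Vec as V using (Vec; toList)
import Data.Vec.Properties as V
open import Function using (id; _∘_; _⇔_; mk⇔; Equivalence)
import Function.Properties.Equivalence as ⇔
open import Relation.Binary.Definitions using (tri<; tri≈; tri>)
open import Relation.Binary.PropositionalEquality
open import Relation.Nullary using (¬_; yes; no; does)
open import Relation.Nullary.Decidable using (⌊_⌋; toWitness; fromWitness)

open Equivalence using (to; from)

private
  variable
    A B C : Set

AllPairs-map⁺-on : {P : A → Set} {R : A → A → Set} {S : B → B → Set} {f : A → B} →
                   (∀ {x y} → P x → P y → R x y → S (f x) (f y)) →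
                   ∀ {xs} → All P xs → AllPairs R xs → AllPairs S (map f xs)
AllPairs-map⁺-on pres []         []         = []
AllPairs-map⁺-on pres (px ∷ pxs) (rx ∷ rxs) =
  All.map⁺ (All.zipWith (λ (py , r) → pres px py r) (pxs , rx)) ∷ AllPairs-map⁺-on pres pxs rxs

Unique-map⇒injectiveOn : (f : A → B) {xs : List A} → Unique (map f xs) →
                         ∀ {x y} → x ∈ xs → y ∈ xs → f x ≡ f y → x ≡ y
Unique-map⇒injectiveOn f (_ ∷ u) (here refl) (here refl) _ = refl
Unique-map⇒injectiveOn f (d ∷ u) (here refl) (there y∈) e  = ⊥-elim (All.lookup d (∈-map⁺ f y∈) e)
Unique-map⇒injectiveOn f (d ∷ u) (there x∈) (here refl) e  = ⊥-elim (All.lookup d (∈-map⁺ f x∈) (sym e))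
Unique-map⇒injectiveOn f (_ ∷ u) (there x∈) (there y∈) e   = Unique-map⇒injectiveOn f u x∈ y∈ e

toList-injective : ∀ {n} {u v : Vec A n} → toList u ≡ toList v → u ≡ v
toList-injective {u = u} {v} eq = trans (sym (V.cast-is-id refl u)) (V.toList-injective refl u v eq)

concatMap-map≡map-cartesianProduct : (f : A × B → C) (xs : List A) (ys : List B) →
  concatMap (λ x → map (λ y → f (x , y)) ys) xs ≡ map f (cartesianProduct xs ys)
concatMap-map≡map-cartesianProduct f []       ys = refl
concatMap-map≡map-cartesianProduct f (x ∷ xs) ys = begin
  map (λ y → f (x , y)) ys ++ concatMap (λ x → map (λ y → f (x , y)) ys) xs
    ≡⟨ cong₂ _++_ (L.map-∘ ys) (concatMap-map≡map-cartesianProduct f xs ys) ⟩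
  map f (map (x ,_) ys) ++ map f (cartesianProduct xs ys)
    ≡⟨ L.map-++ f (map (x ,_) ys) _ ⟨
  map f (cartesianProduct (x ∷ xs) ys) ∎
  where open ≡-Reasoning

sumℚ-map-zero : (f : A → ℚ) (xs : List A) → (∀ {x} → x ∈ xs → f x ≡ 0ℚ) → sumℚ (map f xs) ≡ 0ℚ
sumℚ-map-zero f []       _  = refl
sumℚ-map-zero f (x ∷ xs) f0 =
  trans (cong₂ ℚ._+_ (f0 (here refl)) (sumℚ-map-zero f xs (f0 ∘ there))) (ℚ.+-identityˡ 0ℚ)

sumℚ-map-single : (f : A → ℚ) {xs : List A} → Unique xs → ∀ {x₀} → x₀ ∈ xs → f x₀ ≡ 1ℚ →
                  (∀ {x} → x ∈ xs → f x ≡ 0ℚ ⊎ x ≡ x₀) → sumℚ (map f xs) ≡ 1ℚ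
sumℚ-map-single f {x ∷ xs} (x∉ ∷ u) (here refl) f1 f01 =
  trans (cong₂ ℚ._+_ f1 (sumℚ-map-zero f xs others)) (ℚ.+-identityʳ 1ℚ)
  where
  others : ∀ {y} → y ∈ xs → f y ≡ 0ℚ
  others y∈ with f01 (there y∈)
  ... | inj₁ f0   = f0
  ... | inj₂ refl = ⊥-elim (All.lookup x∉ y∈ refl)
sumℚ-map-single f {x ∷ xs} (x∉ ∷ u) (there x₀∈) f1 f01 =
  trans (cong₂ ℚ._+_ head0 (sumℚ-map-single f u x₀∈ f1 (f01 ∘ there))) (ℚ.+-identityˡ 1ℚ)
  where
  head0 : f x ≡ 0ℚ
  head0 with f01 (here refl)
  ... | inj₁ f0   = f0
  ... | inj₂ refl = ⊥-elim (All.lookup x∉ x₀∈ refl)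

idxOf : ℤ → List ℤ → ℕ
idxOf x []       = 0
idxOf x (y ∷ ys) with x ℤ.≟ y
... | yes _ = 0
... | no  _ = suc (idxOf x ys)

∈-at : ∀ (xs : List ℤ) {k} → k < length xs → at xs k ∈ xs
∈-at (x ∷ xs) {zero}  _       = here refl
∈-at (x ∷ xs) {suc k} (s≤s p) = there (∈-at xs p)

at-idxOf : ∀ {x} (xs : List ℤ) → x ∈ xs → at xs (idxOf x xs) ≡ x
at-idxOf {x} (y ∷ ys) x∈ with x ℤ.≟ y | x∈
... | yes x≡y | _         = sym x≡y
... | no  x≢y | here x≡y  = ⊥-elim (x≢y x≡y)
... | no  _   | there x∈′ = at-idxOf ys x∈′

idxOf<length : ∀ {x} (xs : List ℤ) → x ∈ xs → idxOf x xs < length xs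
idxOf<length {x} (y ∷ ys) x∈ with x ℤ.≟ y | x∈
... | yes _   | _         = s≤s z≤n
... | no  x≢y | here x≡y  = ⊥-elim (x≢y x≡y)
... | no  _   | there x∈′ = s≤s (idxOf<length ys x∈′)

idxOf-at : ∀ {xs : List ℤ} → Unique xs → ∀ {k} → k < length xs → idxOf (at xs k) xs ≡ k
idxOf-at {y ∷ ys} _ {zero} _ with y ℤ.≟ y
... | yes _   = refl
... | no  y≢y = ⊥-elim (y≢y refl)
idxOf-at {y ∷ ys} (y∉ ∷ u) {suc k} (s≤s p) with at ys k ℤ.≟ y
... | yes e = ⊥-elim (All.lookup y∉ (∈-at ys p) (sym e))
... | no  _ = cong suc (idxOf-at u p)

at-injective-∣∣ : ∀ {xs : List ℤ} → Unique (map ∣_∣ xs) →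
                  ∀ {k k′} → k < length xs → k′ < length xs → ∣ at xs k ∣ ≡ ∣ at xs k′ ∣ → k ≡ k′
at-injective-∣∣ {xs} u {k} {k′} p p′ e = begin
  k                    ≡⟨ idxOf-at (Unique.map⁻ u) p ⟨
  idxOf (at xs k)  xs  ≡⟨ cong (λ x → idxOf x xs) at≡at ⟩
  idxOf (at xs k′) xs  ≡⟨ idxOf-at (Unique.map⁻ u) p′ ⟩
  k′                   ∎
  where
  open ≡-Reasoning
  at≡at = Unique-map⇒injectiveOn ∣_∣ u (∈-at xs p) (∈-at xs p′) e

Increasing : List ℤ → Set
Increasing = AllPairs ℤ._<_

at-mono : ∀ {xs} → Increasing xs → ∀ {k k′} → k < k′ → k′ < length xs → at xs k ℤ.< at xs k′
at-mono {x ∷ xs} (x< ∷ _)  {zero}  {suc k′} _       (s≤s p) = All.lookup x< (∈-at xs p)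
at-mono {x ∷ xs} (_ ∷ inc) {suc k} {suc k′} (s≤s q) (s≤s p) = at-mono inc q p

idxOf-mono : ∀ {xs} → Increasing xs → ∀ {x y} → x ∈ xs → y ∈ xs → x ℤ.< y → idxOf x xs < idxOf y xs
idxOf-mono {xs} inc {x} {y} x∈ y∈ x<y with ℕ.<-cmp (idxOf x xs) (idxOf y xs)
... | tri< lt _ _ = lt
... | tri≈ _ eq _ =
  ⊥-elim (ℤ.<-irrefl (trans (sym (at-idxOf xs x∈)) (trans (cong (at xs) eq) (at-idxOf xs y∈))) x<y)
... | tri> _ _ gt = ⊥-elim (ℤ.<-asym x<y
  (subst₂ ℤ._<_ (at-idxOf xs y∈) (at-idxOf xs x∈) (at-mono inc gt (idxOf<length xs x∈))))

⊆-drop-head : ∀ {y xs ys} → All (y ℤ.<_) xs → xs ⊆ y ∷ ys → xs ⊆ ys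
⊆-drop-head y< xs⊆ z∈ with xs⊆ z∈
... | here refl = ⊥-elim (ℤ.<-irrefl refl (All.lookup y< z∈))
... | there z∈′ = z∈′

Increasing-⊆ : ∀ {xs ys} → Increasing xs → Increasing ys → xs ⊆ ys → xs ≡ ys ⊎ length xs < length ys
Increasing-⊆ {[]}     {[]}     _ _ _ = inj₁ refl
Increasing-⊆ {[]}     {y ∷ ys} _ _ _ = inj₂ (s≤s z≤n)
Increasing-⊆ {x ∷ xs} {[]}     _ _ xs⊆ with xs⊆ (here refl)
... | ()
Increasing-⊆ {x ∷ xs} {y ∷ ys} (x< ∷ incx) (y< ∷ incy) xs⊆ with xs⊆ (here refl)
... | here refl with Increasing-⊆ incx incy (⊆-drop-head x< (xs⊆ ∘ there))
...   | inj₁ eq = inj₁ (cong (x ∷_) eq)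
...   | inj₂ lt = inj₂ (s≤s lt)
Increasing-⊆ {x ∷ xs} {y ∷ ys} (x< ∷ incx) (y< ∷ incy) xs⊆ | there x∈ys
  with Increasing-⊆ (x< ∷ incx) incy (⊆-drop-head (y<x ∷ All.map (ℤ.<-trans y<x) x<) xs⊆)
  where y<x = All.lookup y< x∈ys
... | inj₁ refl = inj₂ ℕ.≤-refl
... | inj₂ lt   = inj₂ (ℕ.m<n⇒m<1+n lt)

record Entry (n : ℕ) (x : ℤ) : Set where
  constructor entry
  field
    1≤∣x∣ : 1 ≤ ∣ x ∣
    ∣x∣≤n : ∣ x ∣ ≤ n

Entry-+suc : ∀ {n k} → k < n → Entry n (+ suc k)
Entry-+suc k<n = entry (s≤s z≤n) k<n

Entry-resp-∣∣ : ∀ {n x y} → ∣ x ∣ ≡ ∣ y ∣ → Entry n x → Entry n y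
Entry-resp-∣∣ eq (entry 1≤ ≤n) = entry (subst (1 ≤_) eq 1≤) (subst (_≤ _) eq ≤n)

Entry-pred< : ∀ {n x} → Entry n x → ℕ.pred ∣ x ∣ < n
Entry-pred< {x = + suc k}  (entry _ k<n) = k<n
Entry-pred< {x = -[1+ k ]} (entry _ k<n) = k<n

Entry-suc-pred : ∀ {n x} → Entry n x → ∣ x ∣ ≡ suc (ℕ.pred ∣ x ∣)
Entry-suc-pred {x = + suc k}  _ = refl
Entry-suc-pred {x = -[1+ k ]} _ = refl

SignedPerm : ℕ → List ℤ → Set
SignedPerm n ws = All (Entry n) ws × Unique (map ∣_∣ ws)

SignedPerm-resp-↭∣∣ : ∀ {n xs ys} → map ∣_∣ xs ↭ map ∣_∣ ys → SignedPerm n xs → SignedPerm n ys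
SignedPerm-resp-↭∣∣ {n} p (es , uniq) =
  All.map fromAbs (All.map⁻ (Perm.All-resp-↭ p absEntries)) ,
  PermSetoid.Unique-resp-↭ (setoid ℕ) (↭⇒↭ₛ p) uniq
  where
  absEntries : All (λ m → Entry n (+ m)) (map ∣_∣ _)
  absEntries = All.map⁺ (All.map (Entry-resp-∣∣ refl) es)
  fromAbs : ∀ {x} → Entry n (+ ∣ x ∣) → Entry n x
  fromAbs = Entry-resp-∣∣ refl

T-not : ∀ {b} → T (not b) ⇔ (¬ T b)
T-not {true}  = mk⇔ (λ ()) (λ ¬t → ¬t _)
T-not {false} = mk⇔ (λ _ ()) _

All-⇔ : {P Q : A → Set} → (∀ x → P x ⇔ Q x) → ∀ {xs} → All P xs ⇔ All Q xs
All-⇔ P⇔Q = mk⇔ (All.map (to (P⇔Q _))) (All.map (from (P⇔Q _)))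

T-allB : (p : A → Bool) (xs : List A) → T (allB p xs) ⇔ All (T ∘ p) xs
T-allB p []       = mk⇔ (λ _ → []) _
T-allB p (x ∷ xs) = mk⇔
  (λ t → let (px , pxs) = to (T-∧ {p x}) t in px ∷ to (T-allB p xs) pxs)
  (λ { (px ∷ pxs) → from (T-∧ {p x}) (px , from (T-allB p xs) pxs) })

T-elemℕ : ∀ x ys → T (elemℕ x ys) ⇔ x ∈ ys
T-elemℕ x []       = mk⇔ (λ ()) (λ ())
T-elemℕ x (y ∷ ys) = mk⇔
  (λ t → [ here ∘ ℕ.≡ᵇ⇒≡ x y , there ∘ to (T-elemℕ x ys) ]′ (to (T-∨ {x ≡ᵇ y}) t))
  (λ { (here x≡y) → from (T-∨ {x ≡ᵇ y}) (inj₁ (ℕ.≡⇒≡ᵇ x y x≡y))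
     ; (there x∈) → from (T-∨ {x ≡ᵇ y}) (inj₂ (from (T-elemℕ x ys) x∈)) })

T-distinct : ∀ xs → T (distinct xs) ⇔ Unique xs
T-distinct []       = mk⇔ (λ _ → []) _
T-distinct (x ∷ xs) = ⇔.trans T-∧ (mk⇔
  (λ (x∉ , d) → fresh⇒All x∉ ∷ to (T-distinct xs) d)
  (λ { (x∉ ∷ u) → All⇒fresh x∉ , from (T-distinct xs) u }))
  where
  fresh⇒All : T (not (elemℕ x xs)) → All (x ≢_) xs
  fresh⇒All t = All.¬Any⇒All¬ xs (to T-not t ∘ from (T-elemℕ x xs))
  All⇒fresh : All (x ≢_) xs → T (not (elemℕ x xs))
  All⇒fresh x∉ = from T-not (All.All¬⇒¬Any x∉ ∘ to (T-elemℕ x xs))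

T-entry : ∀ n x → T ((1 ≤ᵇ ∣ x ∣) ∧ (∣ x ∣ ≤ᵇ n)) ⇔ Entry n x
T-entry n x = ⇔.trans T-∧ (mk⇔
  (λ (1≤ , ≤n) → entry (ℕ.≤ᵇ⇒≤ 1 ∣ x ∣ 1≤) (ℕ.≤ᵇ⇒≤ ∣ x ∣ n ≤n))
  (λ (entry 1≤ ≤n) → ℕ.≤⇒≤ᵇ 1≤ , ℕ.≤⇒≤ᵇ ≤n))

T-isSigned : ∀ n (w : Vec ℤ n) → T (isSigned n w) ⇔ SignedPerm n (toList w)
T-isSigned n w = ⇔.trans T-∧ (⇔.trans (T-allB _ (toList w)) (All-⇔ (T-entry n)) ×-⇔ T-distinct _)

T-increasing : ∀ xs → T (increasing xs) ⇔ Increasing xs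
T-increasing xs = mk⇔ (increasing⇒ xs) (⇒increasing xs)
  where
  increasing⇒ : ∀ xs → T (increasing xs) → Increasing xs
  increasing⇒ []           _ = []
  increasing⇒ (x ∷ [])     _ = [] ∷ []
  increasing⇒ (x ∷ y ∷ ys) t =
    let (x<y , t′) = to (T-∧ {⌊ x ℤ.<? y ⌋}) t in extend (toWitness x<y) (increasing⇒ (y ∷ ys) t′)
    where
    extend : ∀ {x y ys} → x ℤ.< y → Increasing (y ∷ ys) → Increasing (x ∷ y ∷ ys)
    extend x<y inc@(y< ∷ _) = (x<y ∷ All.map (ℤ.<-trans x<y) y<) ∷ inc
  ⇒increasing : ∀ xs → Increasing xs → T (increasing xs)
  ⇒increasing []           _                 = _
  ⇒increasing (x ∷ [])     _                 = _
  ⇒increasing (x ∷ y ∷ ys) ((x<y ∷ _) ∷ inc) = from T-∧ (fromWitness x<y , ⇒increasing (y ∷ ys) inc)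

∈-entries : ∀ n {x} → Entry n x → x ∈ entries n
∈-entries n {+ suc k}   (entry _ k<n) = ∈-++⁺ˡ (∈-map⁺ (λ k → + suc k) (∈-upTo⁺ k<n))
∈-entries n { -[1+ k ]} (entry _ k<n) = ∈-++⁺ʳ _ (∈-map⁺ -[1+_] (∈-upTo⁺ k<n))

entries-unique : ∀ n → Unique (entries n)
entries-unique n = Unique.++⁺ (Unique.map⁺ +suc-injective (Unique.upTo⁺ n))
                              (Unique.map⁺ -[1+]-injective (Unique.upTo⁺ n)) disjoint
  where
  +suc-injective : ∀ {k l} → + suc k ≡ + suc l → k ≡ l
  +suc-injective refl = refl
  -[1+]-injective : ∀ {k l} → -[1+ k ] ≡ -[1+ l ] → k ≡ l
  -[1+]-injective refl = refl
  disjoint : ∀ {x} → ¬ (x ∈ map (λ k → + suc k) (upTo n) × x ∈ map -[1+_] (upTo n))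
  disjoint (x∈₁ , x∈₂) with ∈-map⁻ (λ k → + suc k) x∈₁ | ∈-map⁻ -[1+_] x∈₂
  ... | _ , _ , refl | _ , _ , ()

allVecs≡map-cartesianProduct : ∀ n m →
  allVecs n (suc m) ≡ map (λ (x , v) → x V.∷ v) (cartesianProduct (entries n) (allVecs n m))
allVecs≡map-cartesianProduct n m = concatMap-map≡map-cartesianProduct _ (entries n) (allVecs n m)

allVecs-unique : ∀ n m → Unique (allVecs n m)
allVecs-unique n zero    = [] ∷ []
allVecs-unique n (suc m) rewrite allVecs≡map-cartesianProduct n m =
  Unique.map⁺ ∷-injective (Unique.cartesianProduct⁺ (entries-unique n) (allVecs-unique n m))
  where
  ∷-injective : ∀ {p q : ℤ × Vec ℤ m} → proj₁ p V.∷ proj₂ p ≡ proj₁ q V.∷ proj₂ q → p ≡ q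
  ∷-injective refl = refl

∈-allVecs : ∀ n m (v : Vec ℤ m) → All (Entry n) (toList v) → v ∈ allVecs n m
∈-allVecs n zero    V.[]      _         = here refl
∈-allVecs n (suc m) (x V.∷ v) (x∈ ∷ v∈) rewrite allVecs≡map-cartesianProduct n m =
  ∈-map⁺ _ (∈-cartesianProduct⁺ (∈-entries n x∈) (∈-allVecs n m v v∈))

Bn-unique : ∀ n → Unique (Bn n)
Bn-unique n = Unique.filter⁺ _ (allVecs-unique n n)

∈-Bn : ∀ n {v : Vec ℤ n} → SignedPerm n (toList v) → v ∈ Bn n
∈-Bn n {v} σ = ∈-filter⁺ (λ w → T? (isSigned n w)) (∈-allVecs n n v (proj₁ σ)) (from (T-isSigned n v) σ)

orient : Bool → ℤ → ℤ
orient true  x = x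
orient false x = - x

orient-involutive : ∀ b x → orient b (orient b x) ≡ x
orient-involutive true  x = refl
orient-involutive false x = ℤ.neg-involutive x

∣orient∣ : ∀ b x → ∣ orient b x ∣ ≡ ∣ x ∣
∣orient∣ true  x = refl
∣orient∣ false x = ℤ.∣-i∣≡∣i∣ x

orient-conj-< : ∀ b {P : ℤ → Set} {f : ℤ → ℤ} →
                (∀ {x y} → P x → P y → x ℤ.< y → f x ℤ.< f y) →
                ∀ {x y} → P (orient b x) → P (orient b y) → x ℤ.< y →
                orient b (f (orient b x)) ℤ.< orient b (f (orient b y))
orient-conj-< true  mono px py x<y = mono px py x<y
orient-conj-< false mono px py x<y = ℤ.neg-mono-< (mono py px (ℤ.neg-mono-< x<y))

HasSign : Bool → ℤ → Set
HasSign b x = + 0 ℤ.< orient b x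

act-neg : ∀ {n} (u : Vec ℤ n) x → act u (- x) ≡ - act u x
act-neg u (+ zero)  = refl
act-neg u (+ suc k) = refl
act-neg u -[1+ k ]  = sym (ℤ.neg-involutive _)

act-orient : ∀ {n} (u : Vec ℤ n) b x → act u (orient b x) ≡ orient b (act u x)
act-orient u true  x = refl
act-orient u false x = act-neg u x

∣act∣≡∣at∣ : ∀ {n} (u : Vec ℤ n) {x} → Entry n x →
             ∣ act u x ∣ ≡ ∣ at (toList u) (ℕ.pred ∣ x ∣) ∣
∣act∣≡∣at∣ u {+ suc k}  _ = refl
∣act∣≡∣at∣ u { -[1+ k ]} _ = ℤ.∣-i∣≡∣i∣ (at (toList u) k)

module _ {n} (u : Vec ℤ n) where

  private
    us = toList u

    idx<length : ∀ {x} → Entry n x → ℕ.pred ∣ x ∣ < length us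
    idx<length e = subst (_ <_) (sym (V.length-toList u)) (Entry-pred< e)

  act-Entry : All (Entry n) us → ∀ {x} → Entry n x → Entry n (act u x)
  act-Entry es e =
    Entry-resp-∣∣ (sym (∣act∣≡∣at∣ u e)) (All.lookup es (∈-at us (idx<length e)))

  act-∣∣-injective : Unique (map ∣_∣ us) →
                     ∀ {x y} → Entry n x → Entry n y → ∣ act u x ∣ ≡ ∣ act u y ∣ → ∣ x ∣ ≡ ∣ y ∣
  act-∣∣-injective uniq {x} {y} ex ey e = begin
    ∣ x ∣               ≡⟨ Entry-suc-pred ex ⟩
    suc (ℕ.pred ∣ x ∣)  ≡⟨ cong suc (at-injective-∣∣ uniq (idx<length ex) (idx<length ey) ∣at∣≡∣at∣) ⟩
    suc (ℕ.pred ∣ y ∣)  ≡⟨ Entry-suc-pred ey ⟨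
    ∣ y ∣               ∎
    where
    open ≡-Reasoning
    ∣at∣≡∣at∣ = trans (sym (∣act∣≡∣at∣ u ex)) (trans e (∣act∣≡∣at∣ u ey))

  act-SignedPerm : SignedPerm n us → ∀ {vs} → SignedPerm n vs → SignedPerm n (map (act u) vs)
  act-SignedPerm (es , uniq) {vs} (evs , uniqv) =
    All.map⁺ (All.map (act-Entry es) evs) ,
    subst Unique (L.map-∘ vs)
      (AllPairs-map⁺-on (λ ex ey ∣x∣≢∣y∣ → ∣x∣≢∣y∣ ∘ act-∣∣-injective uniq ex ey)
                        evs (AllPairs.map⁻ uniqv))

  act-positive-∈ : ∀ {x} → Entry n x → + 0 ℤ.< x → act u x ∈ us
  act-positive-∈ {+ suc k} e _ = ∈-at us (idx<length e)

  act-positive-mono : Increasing us → ∀ {x y} → Entry n x × + 0 ℤ.< x → Entry n y × + 0 ℤ.< y →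
                      x ℤ.< y → act u x ℤ.< act u y
  act-positive-mono inc {+ suc k} {+ suc l} _ (ey , _) (+<+ (s≤s k<l)) = at-mono inc k<l (idx<length ey)

  orient-Entry : ∀ b {x} → Entry n x → HasSign b x → Entry n (orient b x) × + 0 ℤ.< orient b x
  orient-Entry b {x} e s = Entry-resp-∣∣ (sym (∣orient∣ b x)) e , s

  orient-act-∈ : ∀ b {x} → Entry n x → HasSign b x → orient b (act u x) ∈ us
  orient-act-∈ b {x} e s =
    subst (_∈ us) (act-orient u b x) (act-positive-∈ (proj₁ (orient-Entry b e s)) s)

  act-HasSign-mono : Increasing us → ∀ b {x y} → Entry n x × HasSign b x → Entry n y × HasSign b y →
                     x ℤ.< y → act u x ℤ.< act u y
  act-HasSign-mono inc b {x} {y} (ex , sx) (ey , sy) x<y = subst₂ ℤ._<_ (unconj x) (unconj y)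
    (orient-conj-< b (act-positive-mono inc) (orient-Entry b ex sx) (orient-Entry b ey sy) x<y)
    where
    unconj : ∀ z → orient b (act u (orient b z)) ≡ act u z
    unconj z = trans (cong (orient b) (act-orient u b z)) (orient-involutive b (act u z))

-- act⁻¹ us inverts act u on the entries covered by us = toList u; elsewhere its value is junk.
act⁻¹ : List ℤ → ℤ → ℤ
act⁻¹ us x with x ∈? us
... | yes _ = + suc (idxOf x us)
... | no  _ = -[1+ idxOf (- x) us ]

Covered : List ℤ → ℤ → Set
Covered us x = Σ Bool λ b → orient b x ∈ us

module _ {n} {us : List ℤ} (σ : SignedPerm n us) where

  opposite-∉ : ∀ {x} → x ∈ us → - x ∉ us
  opposite-∉ {x} x∈ -x∈ with x | All.lookup (proj₁ σ) x∈
       | Unique-map⇒injectiveOn ∣_∣ (proj₂ σ) x∈ -x∈ (sym (ℤ.∣-i∣≡∣i∣ x))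
  ... | + suc _  | _ | ()
  ... | -[1+ _ ] | _ | ()

  act⁻¹-orient : ∀ b {x} → orient b x ∈ us →
                 act⁻¹ us x ≡ orient b (+ suc (idxOf (orient b x) us))
  act⁻¹-orient true  {x} x∈ with x ∈? us
  ... | yes _  = refl
  ... | no x∉ = ⊥-elim (x∉ x∈)
  act⁻¹-orient false {x} -x∈ with x ∈? us
  ... | yes x∈ = ⊥-elim (opposite-∉ x∈ -x∈)
  ... | no _   = refl

  ∣act⁻¹∣ : ∀ b {x} → orient b x ∈ us → ∣ act⁻¹ us x ∣ ≡ suc (idxOf (orient b x) us)
  ∣act⁻¹∣ b x∈ = trans (cong ∣_∣ (act⁻¹-orient b x∈)) (∣orient∣ b _)

  act⁻¹-HasSign : ∀ b {x} → orient b x ∈ us → HasSign b (act⁻¹ us x)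
  act⁻¹-HasSign b x∈ = subst (+ 0 ℤ.<_) (sym orient-act⁻¹) (+<+ (s≤s z≤n))
    where orient-act⁻¹ = trans (cong (orient b) (act⁻¹-orient b x∈)) (orient-involutive b _)

  act⁻¹-HasSign-mono : Increasing us → ∀ b {x y} → orient b x ∈ us → orient b y ∈ us →
                       x ℤ.< y → act⁻¹ us x ℤ.< act⁻¹ us y
  act⁻¹-HasSign-mono inc b x∈ y∈ x<y =
    subst₂ ℤ._<_ (sym (act⁻¹-orient b x∈)) (sym (act⁻¹-orient b y∈))
                 (orient-conj-< b position-mono x∈ y∈ x<y)
    where
    position-mono : ∀ {s t} → s ∈ us → t ∈ us → s ℤ.< t →
                    + suc (idxOf s us) ℤ.< + suc (idxOf t us)
    position-mono s∈ t∈ s<t = +<+ (s≤s (idxOf-mono inc s∈ t∈ s<t))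

  act⁻¹-SignedPerm : length us ≡ n → ∀ {ws} → All (Covered us) ws → SignedPerm n ws →
                     SignedPerm n (map (act⁻¹ us) ws)
  act⁻¹-SignedPerm len {ws} cov (_ , uniqw) =
    All.map⁺ (All.map (λ (b , x∈) → Entry-resp-∣∣ (sym (∣act⁻¹∣ b x∈))
                                       (Entry-+suc (subst (_ <_) len (idxOf<length us x∈)))) cov) ,
    subst Unique (L.map-∘ ws)
      (AllPairs-map⁺-on (λ cx cy ∣x∣≢∣y∣ → ∣x∣≢∣y∣ ∘ injective cx cy) cov (AllPairs.map⁻ uniqw))
    where
    injective : ∀ {x y} → Covered us x → Covered us y →
                ∣ act⁻¹ us x ∣ ≡ ∣ act⁻¹ us y ∣ → ∣ x ∣ ≡ ∣ y ∣
    injective {x} {y} (b , x∈) (c , y∈) e = begin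
      ∣ x ∣                             ≡⟨ ∣orient∣ b x ⟨
      ∣ orient b x ∣                    ≡⟨ cong ∣_∣ (at-idxOf us x∈) ⟨
      ∣ at us (idxOf (orient b x) us) ∣ ≡⟨ cong (∣_∣ ∘ at us) same-position ⟩
      ∣ at us (idxOf (orient c y) us) ∣ ≡⟨ cong ∣_∣ (at-idxOf us y∈) ⟩
      ∣ orient c y ∣                    ≡⟨ ∣orient∣ c y ⟩
      ∣ y ∣                             ∎
      where
      open ≡-Reasoning
      same-position = ℕ.suc-injective (trans (sym (∣act⁻¹∣ b x∈)) (trans e (∣act⁻¹∣ c y∈)))

module _ {n} (u : Vec ℤ n) (σ : SignedPerm n (toList u)) where

  private
    us = toList u

  act∘act⁻¹ : ∀ {x} → Covered us x → act u (act⁻¹ us x) ≡ x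
  act∘act⁻¹ {x} (b , x∈) = begin
    act u (act⁻¹ us x)                               ≡⟨ cong (act u) (act⁻¹-orient σ b x∈) ⟩
    act u (orient b (+ suc (idxOf (orient b x) us))) ≡⟨ act-orient u b _ ⟩
    orient b (at us (idxOf (orient b x) us))         ≡⟨ cong (orient b) (at-idxOf us x∈) ⟩
    orient b (orient b x)                            ≡⟨ orient-involutive b x ⟩
    x                                                ∎
    where open ≡-Reasoning

  act⁻¹∘act-orient : ∀ b {k} → k < n → act⁻¹ us (act u (orient b (+ suc k))) ≡ orient b (+ suc k)
  act⁻¹∘act-orient b {k} k<n = begin
    act⁻¹ us (act u y)
      ≡⟨ act⁻¹-orient σ b (subst (_∈ us) (sym orient-act) at∈) ⟩
    orient b (+ suc (idxOf (orient b (act u y)) us))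
      ≡⟨ cong (λ z → orient b (+ suc (idxOf z us))) orient-act ⟩
    orient b (+ suc (idxOf (at us k) us))
      ≡⟨ cong (λ i → orient b (+ suc i)) (idxOf-at (Unique.map⁻ (proj₂ σ)) k<) ⟩
    y ∎
    where
    open ≡-Reasoning
    y = orient b (+ suc k)
    k< = subst (k <_) (sym (V.length-toList u)) k<n
    at∈ = ∈-at us k<
    orient-act : orient b (act u y) ≡ at us k
    orient-act = trans (sym (act-orient u b y)) (cong (act u) (orient-involutive b (+ suc k)))

  act⁻¹∘act : ∀ {y} → Entry n y → act⁻¹ us (act u y) ≡ y
  act⁻¹∘act {+ suc k}   e = act⁻¹∘act-orient true  (Entry-pred< e)
  act⁻¹∘act { -[1+ k ]} e = act⁻¹∘act-orient false (Entry-pred< e)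

SortedBlocks : List ℕ → List ℤ → Set
SortedBlocks []      ws = ⊤
SortedBlocks (c ∷ γ) ws = Increasing (take c ws) × SortedBlocks γ (drop c ws)

SignedBlocks : List ℤ → List ℤ → Set
SignedBlocks []      vs = ⊤
SignedBlocks (a ∷ α) vs =
  Increasing (take ∣ a ∣ vs) × All (HasSign (positive a)) (take ∣ a ∣ vs) ×
  SignedBlocks α (drop ∣ a ∣ vs)

T-x0Cond : ∀ γ ws → T (x0Cond γ ws) ⇔ SortedBlocks γ ws
T-x0Cond []      ws = mk⇔ _ _
T-x0Cond (c ∷ γ) ws = ⇔.trans T-∧ (T-increasing (take c ws) ×-⇔ T-x0Cond γ (drop c ws))

T-sameSign : ∀ a xs → T (sameSign a xs) ⇔ All (HasSign (positive a)) xs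
T-sameSign a xs with positive a
... | true  = ⇔.trans (T-allB positive xs) (All-⇔ λ _ → mk⇔ toWitness fromWitness)
... | false = ⇔.trans (T-allB negative xs)
                      (All-⇔ λ x → mk⇔ (ℤ.neg-mono-< ∘ toWitness) (fromWitness ∘ ℤ.neg-cancel-< {+ 0} {x}))

T-stildeCond : ∀ α vs → T (stildeCond α vs) ⇔ SignedBlocks α vs
T-stildeCond []      vs = mk⇔ _ _
T-stildeCond (a ∷ α) vs =
  ⇔.trans T-∧ (T-increasing _ ×-⇔
               ⇔.trans T-∧ (T-sameSign a _ ×-⇔ T-stildeCond α (drop ∣ a ∣ vs)))

-- The entries εᵢ w_j (j in the i-th block, εᵢ the sign of aᵢ) that every left factor u must contain.
leftEntries : List ℤ → List ℤ → List ℤ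
leftEntries []      ws = []
leftEntries (a ∷ α) ws = map (orient (positive a)) (take ∣ a ∣ ws) ++ leftEntries α (drop ∣ a ∣ ws)

length-drop-block : ∀ k α (ws : List ℤ) → k ℕ.+ sum α ≡ length ws → sum α ≡ length (drop k ws)
length-drop-block k α ws eq =
  sym (trans (L.length-drop k ws) (trans (cong (ℕ._∸ k) (sym eq)) (ℕ.m+n∸m≡n k (sum α))))

leftEntries-∣∣ : ∀ α ws → sum (map ∣_∣ α) ≡ length ws → map ∣_∣ (leftEntries α ws) ≡ map ∣_∣ ws
leftEntries-∣∣ []      []       _  = refl
leftEntries-∣∣ (a ∷ α) ws       eq = begin
  map ∣_∣ (map (orient (positive a)) (take k ws) ++ leftEntries α (drop k ws))
    ≡⟨ L.map-++ ∣_∣ (map (orient (positive a)) (take k ws)) _ ⟩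
  map ∣_∣ (map (orient (positive a)) (take k ws)) ++ map ∣_∣ (leftEntries α (drop k ws))
    ≡⟨ cong₂ _++_ (trans (sym (L.map-∘ (take k ws))) (L.map-cong (∣orient∣ (positive a)) (take k ws)))
                  (leftEntries-∣∣ α (drop k ws) (length-drop-block k (map ∣_∣ α) ws eq)) ⟩
  map ∣_∣ (take k ws) ++ map ∣_∣ (drop k ws)
    ≡⟨ sym (L.map-++ ∣_∣ (take k ws) (drop k ws)) ⟩
  map ∣_∣ (take k ws ++ drop k ws)
    ≡⟨ cong (map ∣_∣) (L.take++drop≡id k ws) ⟩
  map ∣_∣ ws ∎
  where
  open ≡-Reasoning
  k = ∣ a ∣

leftEntries-Covered : ∀ α ws → sum (map ∣_∣ α) ≡ length ws → All (Covered (leftEntries α ws)) ws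
leftEntries-Covered []      []       _  = []
leftEntries-Covered (a ∷ α) ws       eq = subst (All _) (L.take++drop≡id k ws) (All.++⁺
  (All.tabulate λ x∈ → positive a , ∈-++⁺ˡ (∈-map⁺ (orient (positive a)) x∈))
  (All.map (λ (b , x∈) → b , ∈-++⁺ʳ _ x∈) (leftEntries-Covered α (drop k ws) eq′)))
  where
  k = ∣ a ∣
  eq′ = length-drop-block k (map ∣_∣ α) ws eq

module _ {n} (u : Vec ℤ n) where

  private
    us = toList u

  act-SortedBlocks : Increasing us → ∀ α {vs} → All (Entry n) vs → SignedBlocks α vs →
                     SortedBlocks (absComp α) (map (act u) vs)
  act-SortedBlocks inc []      _   _                    = _
  act-SortedBlocks inc (a ∷ α) {vs} evs (incb , sgnb , blocks) =
    subst Increasing (sym (L.take-map k vs))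
      (AllPairs-map⁺-on (act-HasSign-mono u inc (positive a)) (All.zip (All.take⁺ k evs , sgnb)) incb) ,
    subst (SortedBlocks (absComp α)) (sym (L.drop-map k vs))
      (act-SortedBlocks inc α (All.drop⁺ k evs) blocks)
    where k = ∣ a ∣

  leftEntries-act : ∀ α {vs} → All (Entry n) vs → SignedBlocks α vs →
                    All (_∈ us) (leftEntries α (map (act u) vs))
  leftEntries-act []      _   _                 = []
  leftEntries-act (a ∷ α) {vs} evs (_ , sgnb , blocks) = All.++⁺
    (All.map⁺ (subst (All _) (sym (L.take-map k vs)) (All.map⁺ block∈)))
    (subst (λ xs → All (_∈ us) (leftEntries α xs)) (sym (L.drop-map k vs))
      (leftEntries-act α (All.drop⁺ k evs) blocks))
    where
    k = ∣ a ∣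
    block∈ : All (λ y → orient (positive a) (act u y) ∈ us) (take k vs)
    block∈ = All.zipWith (λ (e , s) → orient-act-∈ u (positive a) e s) (All.take⁺ k evs , sgnb)

module _ {n} {us : List ℤ} (σ : SignedPerm n us) (inc : Increasing us) where

  act⁻¹-SignedBlocks : ∀ α {ws} → All (_∈ us) (leftEntries α ws) → SortedBlocks (absComp α) ws →
                       SignedBlocks α (map (act⁻¹ us) ws)
  act⁻¹-SignedBlocks []      _      _              = _
  act⁻¹-SignedBlocks (a ∷ α) {ws} left∈ (incb , blocks) =
    subst Increasing (sym (L.take-map k ws)) (AllPairs-map⁺-on (act⁻¹-HasSign-mono σ inc b) block∈ incb) ,
    subst (All (HasSign b)) (sym (L.take-map k ws)) (All.map⁺ (All.map (act⁻¹-HasSign σ b) block∈)) ,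
    subst (SignedBlocks α) (sym (L.drop-map k ws)) (act⁻¹-SignedBlocks α (All.++⁻ʳ _ left∈) blocks)
    where
    k = ∣ a ∣
    b = positive a
    block∈ : All (λ x → orient b x ∈ us) (take k ws)
    block∈ = All.map⁻ (All.++⁻ˡ _ left∈)

-- Factorisations w = u v

record Factorisation (n : ℕ) (α : List ℤ) (w u v : Vec ℤ n) : Set where
  field
    composes     : compose u v ≡ w
    left-perm    : SignedPerm n (toList u)
    left-inc     : Increasing (toList u)
    right-perm   : SignedPerm n (toList v)
    right-blocks : SignedBlocks α (toList v)

  window≡ : toList w ≡ map (act u) (toList v)
  window≡ = trans (cong toList (sym composes)) (V.toList-map (act u) v)

module _ {n α} {w u v : Vec ℤ n} (f : Factorisation n α w u v) where

  open Factorisation f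

  Factorisation-SortedBlocks : SignedPerm n (toList w) × SortedBlocks (absComp α) (toList w)
  Factorisation-SortedBlocks =
    subst (λ ws → SignedPerm n ws × SortedBlocks (absComp α) ws) (sym window≡)
      (act-SignedPerm u left-perm right-perm , act-SortedBlocks u left-inc α (proj₁ right-perm) right-blocks)

  leftEntries⊆left : leftEntries α (toList w) ⊆ toList u
  leftEntries⊆left = All.lookup (subst (λ ws → All (_∈ toList u) (leftEntries α ws)) (sym window≡)
    (leftEntries-act u α (proj₁ right-perm) right-blocks))

module CanonicalFactorisation {n α} (w : Vec ℤ n) (|α|≡n : sum (map ∣_∣ α) ≡ n)
                              (σw : SignedPerm n (toList w))
                              (sorted : SortedBlocks (absComp α) (toList w)) where

  private
    ws = toList w
    S  = leftEntries α ws

    |α|≡length : sum (map ∣_∣ α) ≡ length ws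
    |α|≡length = trans |α|≡n (sym (V.length-toList w))

    sort-∣∣ : map ∣_∣ (sort S) ↭ map ∣_∣ ws
    sort-∣∣ = subst (map ∣_∣ (sort S) ↭_) (leftEntries-∣∣ α ws |α|≡length) (Perm.map⁺ ∣_∣ (sort-↭ S))

    sort-perm : SignedPerm n (sort S)
    sort-perm = SignedPerm-resp-↭∣∣ (↭-sym sort-∣∣) σw

    length-sort : length (sort S) ≡ n
    length-sort = begin
      length (sort S)           ≡⟨ L.length-map ∣_∣ (sort S) ⟨
      length (map ∣_∣ (sort S)) ≡⟨ Perm.↭-length sort-∣∣ ⟩
      length (map ∣_∣ ws)       ≡⟨ L.length-map ∣_∣ ws ⟩
      length ws                 ≡⟨ V.length-toList w ⟩
      n                         ∎
      where open ≡-Reasoning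

  u* : Vec ℤ n
  u* = V.cast length-sort (V.fromList (sort S))

  v* : Vec ℤ n
  v* = V.map (act⁻¹ (toList u*)) w

  private
    toList-u* : toList u* ≡ sort S
    toList-u* = trans (V.toList-cast length-sort _) (V.toList∘fromList (sort S))

    u*-perm : SignedPerm n (toList u*)
    u*-perm = subst (SignedPerm n) (sym toList-u*) sort-perm

    u*-inc : Increasing (toList u*)
    u*-inc = subst Increasing (sym toList-u*) (AllPairs.zipWith (λ (x≤y , x≢y) → ℤ.≤∧≢⇒< x≤y x≢y)
      (Linked⇒AllPairs ℤ.≤-trans (sort-↗ S) , Unique.map⁻ (proj₂ sort-perm)))

    S⊆u* : S ⊆ toList u*
    S⊆u* = subst (_ ∈_) (sym toList-u*) ∘ Perm.∈-resp-↭ (↭-sym (sort-↭ S))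

    u*⊆S : toList u* ⊆ S
    u*⊆S = Perm.∈-resp-↭ (sort-↭ S) ∘ subst (_ ∈_) toList-u*

    covered : All (Covered (toList u*)) ws
    covered = All.map (λ (b , x∈) → b , S⊆u* x∈) (leftEntries-Covered α ws |α|≡length)

    toList-v* : toList v* ≡ map (act⁻¹ (toList u*)) ws
    toList-v* = V.toList-map _ w

  canonical : Factorisation n α w u* v*
  canonical = record
    { composes     = toList-injective (begin
        toList (compose u* v*)                      ≡⟨ V.toList-map (act u*) v* ⟩
        map (act u*) (toList v*)                    ≡⟨ cong (map (act u*)) toList-v* ⟩
        map (act u*) (map (act⁻¹ (toList u*)) ws)   ≡⟨ L.map-∘ ws ⟨
        map (act u* ∘ act⁻¹ (toList u*)) ws         ≡⟨ L.map-id-local (All.map (act∘act⁻¹ u* u*-perm) covered) ⟩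
        ws                                          ∎)
    ; left-perm    = u*-perm
    ; left-inc     = u*-inc
    ; right-perm   = subst (SignedPerm n) (sym toList-v*)
                       (act⁻¹-SignedPerm u*-perm (V.length-toList u*) covered σw)
    ; right-blocks = subst (SignedBlocks α) (sym toList-v*)
                       (act⁻¹-SignedBlocks u*-perm u*-inc α (All.tabulate S⊆u*) sorted)
    }
    where open ≡-Reasoning

  canonical-unique : ∀ {u v} → Factorisation n α w u v → (u , v) ≡ (u* , v*)
  canonical-unique {u} {v} f = cong₂ _,_ u≡u* (toList-injective (begin
    toList v
      ≡⟨ L.map-id-local (All.map (act⁻¹∘act u left-perm) (proj₁ right-perm)) ⟨
    map (act⁻¹ (toList u) ∘ act u) (toList v)
      ≡⟨ L.map-∘ (toList v) ⟩
    map (act⁻¹ (toList u)) (map (act u) (toList v))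
      ≡⟨ cong₂ (λ us vs → map (act⁻¹ us) vs) (cong toList u≡u*) (sym window≡) ⟩
    map (act⁻¹ (toList u*)) ws
      ≡⟨ toList-v* ⟨
    toList v* ∎))
    where
    open ≡-Reasoning
    open Factorisation f
    u≡u* : u ≡ u*
    u≡u* with Increasing-⊆ u*-inc left-inc (leftEntries⊆left f ∘ u*⊆S)
    ... | inj₁ eq = sym (toList-injective eq)
    ... | inj₂ lt = ⊥-elim (ℕ.<-irrefl (trans (V.length-toList u*) (sym (V.length-toList u))) lt)

indicator-true : ∀ {b} → T b → indicator b ≡ 1ℚ
indicator-true {true} _ = refl

indicator-false : ∀ {b} → ¬ T b → indicator b ≡ 0ℚ
indicator-false {false} _ = refl
indicator-false {true}  ¬t = ⊥-elim (¬t _)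

T-X0 : ∀ n γ (w : Vec ℤ n) →
       T (isSigned n w ∧ x0Cond γ (toList w)) ⇔ (SignedPerm n (toList w) × SortedBlocks γ (toList w))
T-X0 n γ w = ⇔.trans T-∧ (T-isSigned n w ×-⇔ T-x0Cond γ (toList w))

T-X0-single : ∀ n (u : Vec ℤ n) →
              T (isSigned n u ∧ x0Cond (n ∷ []) (toList u)) ⇔ (SignedPerm n (toList u) × Increasing (toList u))
T-X0-single n u = ⇔.trans (T-X0 n (n ∷ []) u) (⇔.refl ×-⇔ mk⇔
  (λ (inc , _) → subst Increasing take-all inc)
  (λ inc → subst Increasing (sym take-all) inc , _))
  where
  take-all : take n (toList u) ≡ toList u
  take-all = L.take-all n (toList u) (ℕ.≤-reflexive (V.length-toList u))

T-Stilde : ∀ n α (v : Vec ℤ n) →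
           T (isSigned n v ∧ stildeCond α (toList v)) ⇔ (SignedPerm n (toList v) × SignedBlocks α (toList v))
T-Stilde n α v = ⇔.trans T-∧ (T-isSigned n v ×-⇔ T-stildeCond α (toList v))

module _ {n} (α : List ℤ) (w : Vec ℤ n) where

  summand : Vec ℤ n × Vec ℤ n → ℚ
  summand (u , v) = if does (V.≡-dec ℤ._≟_ (compose u v) w) then X0 n (n ∷ []) u ℚ.* Stilde n α v else 0ℚ

  ⋆-as-sum : (X0 n (n ∷ []) ⋆ Stilde n α) w ≡ sumℚ (map summand (cartesianProduct (Bn n) (Bn n)))
  ⋆-as-sum = cong sumℚ (concatMap-map≡map-cartesianProduct summand (Bn n) (Bn n))

  summand-cases : ∀ u v → summand (u , v) ≡ 0ℚ ⊎ Factorisation n α w u v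
  summand-cases u v with V.≡-dec ℤ._≟_ (compose u v) w
  ... | no _ = inj₁ refl
  ... | yes uv≡w with T? (isSigned n u ∧ x0Cond (n ∷ []) (toList u))
                   | T? (isSigned n v ∧ stildeCond α (toList v))
  ...   | no ¬l | _     =
    inj₁ (trans (cong (ℚ._* Stilde n α v) (indicator-false ¬l)) (ℚ.*-zeroˡ (Stilde n α v)))
  ...   | yes _ | no ¬r =
    inj₁ (trans (cong (X0 n (n ∷ []) u ℚ.*_) (indicator-false ¬r)) (ℚ.*-zeroʳ (X0 n (n ∷ []) u)))
  ...   | yes l | yes r =
    let (σu , incu) = to (T-X0-single n u) l ; (σv , bv) = to (T-Stilde n α v) r in
    inj₂ (record { composes = uv≡w ; left-perm = σu ; left-inc = incu ; right-perm = σv ; right-blocks = bv })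

  summand-factorisation : ∀ {u v} → Factorisation n α w u v → summand (u , v) ≡ 1ℚ
  summand-factorisation {u} {v} f with V.≡-dec ℤ._≟_ (compose u v) w
  ... | no uv≢w = ⊥-elim (uv≢w (Factorisation.composes f))
  ... | yes _   = trans (cong₂ ℚ._*_ (indicator-true left) (indicator-true right)) (ℚ.*-identityˡ 1ℚ)
    where
    open Factorisation f
    left  = from (T-X0-single n u) (left-perm , left-inc)
    right = from (T-Stilde n α v) (right-perm , right-blocks)

  private
    pairs = cartesianProduct (Bn n) (Bn n)

  ⋆-no-factorisation : (∀ {u v} → ¬ Factorisation n α w u v) → (X0 n (n ∷ []) ⋆ Stilde n α) w ≡ 0ℚ
  ⋆-no-factorisation none = trans ⋆-as-sum (sumℚ-map-zero summand pairs λ {(u , v)} _ →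
    [ id , ⊥-elim ∘ none ]′ (summand-cases u v))

  ⋆-unique-factorisation : ∀ {u₀ v₀} → Factorisation n α w u₀ v₀ →
    (∀ {u v} → Factorisation n α w u v → (u , v) ≡ (u₀ , v₀)) → (X0 n (n ∷ []) ⋆ Stilde n α) w ≡ 1ℚ
  ⋆-unique-factorisation f₀ unique = trans ⋆-as-sum (sumℚ-map-single summand
    (Unique.cartesianProduct⁺ (Bn-unique n) (Bn-unique n))
    (∈-cartesianProduct⁺ (∈-Bn n left-perm) (∈-Bn n right-perm))
    (summand-factorisation f₀)
    λ {(u , v)} _ → [ inj₁ , inj₂ ∘ unique ]′ (summand-cases u v))
    where open Factorisation f₀

proposition7p6 : (n : ℕ) → 1 ≤ n → (α : List ℤ) → T (IsSignedComposition n α) →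
    (w : Vec ℤ n) → (X0 n (n ∷ []) ⋆ Stilde n α) w ≡ X0 n (absComp α) w
proposition7p6 n _ α sc w with T? (isSigned n w ∧ x0Cond (absComp α) (toList w))
... | no ¬good = trans (⋆-no-factorisation α w (¬good ∘ from (T-X0 n _ w) ∘ Factorisation-SortedBlocks))
                       (sym (indicator-false ¬good))
... | yes good = trans (⋆-unique-factorisation α w canonical canonical-unique) (sym (indicator-true good))
  where
  |α|≡n = ℕ.≡ᵇ⇒≡ _ n (proj₂ (to (T-∧ {allB _ α}) sc))
  σw×sorted = to (T-X0 n (absComp α) w) good
  open CanonicalFactorisation w |α|≡n (proj₁ σw×sorted) (proj₂ σw×sorted)
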